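{- Let $k$ be a positive integer. Every $k$-in-out graph $S$ has at least $2k-1$ vertices.
   Context: All graphs are simple, finite, directed graphs. A Hamiltonian path in a directed graph $S$ from $u$ to $w$ is a directed simple path starting at $u$, ending at $w$, and visiting every vertex of $S$ exactly once. Let $S$ be a directed graph in which $k$ distinct vertices are labelled $i_1,\dots,i_k$ (the incoming vertices) and $k$ distinct vertices are labelled $o_1,\dots,o_k$ (the outgoing vertices); a vertex may be both an incoming and an outgoing vertex. $S$ is called a $k$-in-out graph if: (1) (paired vertices condition) for all $j,m\in\{1,\dots,k\}$, there is a Hamiltonian path in $S$ from $i_j$ to $o_m$ if and only if $j=m$; and (2) (single visit condition) there is no collection of two or more pairwise vertex-disjoint directed paths in $S$, each starting at an incoming vertex and finishing at an outgoing vertex (a single vertex that is both incoming and outgoing counts as such a path), whose union covers all vertices of $S$. -}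

module Defs where

open import Data.Nat using (ℕ)
open import Data.Fin using (Fin)
open import Data.List using (List; []; _∷_; length)
open import Data.List.Relation.Unary.Linked using (Linked)
open import Data.List.Relation.Unary.All using (All)
open import Data.List.Relation.Unary.AllPairs using (AllPairs)
open import Data.List.Relation.Unary.Unique.Propositional using (Unique)
open import Data.List.Relation.Binary.Disjoint.Propositional using (Disjoint)
open import Data.List.Membership.Propositional using (_∈_; _∉_)
open import Data.List.Relation.Unary.Any using (Any)
open import Data.Product using (Σ; ∃; _×_)
open import Relation.Binary.PropositionalEquality using (_≡_)
open import Relation.Nullary using (¬_)
open import Function.Definitions using (Injective)

record Digraph : Set₁ where
  field
    n     : ℕ
    Edge  : Fin n → Fin n → Set
    loopless : ∀ v → ¬ Edge v v
open Digraph public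

module _ (G : Digraph) where

  lastOf : Fin (n G) → List (Fin (n G)) → Fin (n G)
  lastOf u []       = u
  lastOf u (y ∷ ys) = lastOf y ys

  IsPathFromTo : Fin (n G) → Fin (n G) → List (Fin (n G)) → Set
  IsPathFromTo u w xs =
    Σ (List (Fin (n G))) λ ys →
      (xs ≡ u ∷ ys) × Linked (Edge G) xs × Unique xs × (lastOf u ys ≡ w)

  Covers : List (Fin (n G)) → Set
  Covers xs = ∀ v → v ∈ xs

  HamPath : Fin (n G) → Fin (n G) → Set
  HamPath u w = Σ (List (Fin (n G))) λ xs → IsPathFromTo u w xs × Covers xs

  CoveredBy : List (List (Fin (n G))) → Set
  CoveredBy ps = ∀ v → Any (v ∈_) ps

-- k-in-out graph: incoming labelling inc, outgoing labelling out
-- (each injective, i.e. k distinct vertices each).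
record IsInOut (k : ℕ) (G : Digraph) (inc out : Fin k → Fin (n G)) : Set where
  field
    inc-injective : Injective _≡_ _≡_ inc
    out-injective : Injective _≡_ _≡_ out
    paired : ∀ j m → (HamPath G (inc j) (out m) → j ≡ m) × (j ≡ m → HamPath G (inc j) (out m))
    single-visit :
      ¬ (Σ (List (List (Fin (n G)))) λ ps →
           (2 Data.Nat.≤ length ps)
         × All (λ p → ∃ λ j → ∃ λ m → IsPathFromTo G (inc j) (out m) p) ps
         × AllPairs Disjoint ps
         × CoveredBy G ps)

-- Take a Hamiltonian path from i₁ to o₁. If an outgoing vertex o_m were immediately
-- followed on it by an incoming vertex i_j, cutting the path between them would give
-- two disjoint paths i₁ → o_m and i_j → o₁ covering S, against the single visit
-- condition. So along the path an outgoing label is never directly followed by an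
-- incoming one, and then the k incoming and k outgoing labels, counted with
-- multiplicity, number at most n + 1; that is 2k ≤ n + 1.
module Submission where

open import Defs
open import Data.Nat using (ℕ; _≤_; _*_; _∸_; suc; _+_; z≤n; s≤s)
open import Data.Nat.Properties using (module ≤-Reasoning; ≤-trans; ≤-reflexive; +-suc; +-identityʳ; n≤1+n; +-mono-≤; ∸-monoˡ-≤)
open import Data.Fin using (Fin; _≟_)
open import Data.Fin.Properties using (any?; injective⇒≤)
open import Data.List using (List; []; _∷_; _++_; length; filter; lookup)
open import Data.List.Relation.Unary.Linked using (Linked; []; [-]; _∷_)
open import Data.List.Relation.Unary.All as All using ([]; _∷_)
open import Data.List.Relation.Unary.All.Properties using (++⁻ˡ)
open import Data.List.Relation.Unary.AllPairs using ([]; _∷_)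
open import Data.List.Relation.Unary.Any as Any using (here; there)
open import Data.List.Relation.Unary.Any.Properties using (lookup-index)
open import Data.List.Relation.Unary.Unique.Propositional using (Unique)
open import Data.List.Relation.Binary.Disjoint.Propositional using (Disjoint)
open import Data.List.Membership.Propositional using (_∈_)
open import Data.List.Membership.Propositional.Properties using (∈-filter⁺; ∈-lookup; ∈-++⁻; ∈-++⁺ʳ)
open import Data.Product using (∃; _×_; _,_; proj₁; proj₂)
open import Data.Sum using (inj₁; inj₂)
open import Data.Empty using (⊥-elim)
open import Function.Definitions using (Injective)
open import Relation.Binary.PropositionalEquality using (_≡_; refl; sym; trans; cong; subst)
open import Relation.Nullary using (¬_; yes; no)
open import Relation.Unary using (Pred; Decidable)

module _ {a} {A : Set a} where

  Linked-++⁻ : ∀ {r} {R : A → A → Set r} xs {ys} → Linked R (xs ++ ys) → Linked R xs × Linked R ys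
  Linked-++⁻ []                     l       = [] , l
  Linked-++⁻ (x ∷ [])     {[]}     l       = [-] , []
  Linked-++⁻ (x ∷ [])     {y ∷ ys} (_ ∷ l) = [-] , l
  Linked-++⁻ (x ∷ y ∷ xs)          (r ∷ l) with Linked-++⁻ (y ∷ xs) l
  ... | lxs , lys = r ∷ lxs , lys

  Unique-++⁻ : ∀ xs {ys : List A} → Unique (xs ++ ys) → Unique xs × Unique ys × Disjoint xs ys
  Unique-++⁻ []       u        = [] , u , λ { (() , _) }
  Unique-++⁻ (x ∷ xs) (x∉ ∷ u) with Unique-++⁻ xs u
  ... | uxs , uys , xs#ys = ++⁻ˡ xs x∉ ∷ uxs , uys , x∷xs#ys
    where
    x∷xs#ys : Disjoint (x ∷ xs) _
    x∷xs#ys (here refl , y) = All.lookup x∉ (∈-++⁺ʳ xs y) refl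
    x∷xs#ys (there x′ , y)  = xs#ys (x′ , y)

  Unique⇒lookup-injective : ∀ {xs : List A} → Unique xs → Injective _≡_ _≡_ (lookup xs)
  Unique⇒lookup-injective {xs = _ ∷ _} (_  ∷ _) {Fin.zero}  {Fin.zero}  _ = refl
  Unique⇒lookup-injective {xs = _ ∷ _} (x∉ ∷ _) {Fin.zero}  {Fin.suc j} e = ⊥-elim (All.lookup x∉ (∈-lookup j) e)
  Unique⇒lookup-injective {xs = _ ∷ _} (x∉ ∷ _) {Fin.suc i} {Fin.zero}  e = ⊥-elim (All.lookup x∉ (∈-lookup i) (sym e))
  Unique⇒lookup-injective {xs = _ ∷ _} (_  ∷ u) {Fin.suc i} {Fin.suc j} e = cong Fin.suc (Unique⇒lookup-injective u e)

  injective-∈⇒≤-length : ∀ {k} {xs : List A} (f : Fin k → A) →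
    Injective _≡_ _≡_ f → (∀ j → f j ∈ xs) → k ≤ length xs
  injective-∈⇒≤-length {xs = xs} f f-inj f∈ = injective⇒≤ index-injective
    where
    index-injective : ∀ {i j} → Any.index (f∈ i) ≡ Any.index (f∈ j) → i ≡ j
    index-injective {i} {j} e =
      f-inj (trans (lookup-index (f∈ i)) (trans (cong (lookup xs) e) (sym (lookup-index (f∈ j)))))

-- Pair the Q-label of each position with the P-label of the next one: each pair
-- contributes at most 1, and only the first P-label and the last Q-label are unpaired.
module _ {a p q} {A : Set a} {P : Pred A p} {Q : Pred A q} (P? : Decidable P) (Q? : Decidable Q) where

  private
    labels : List A → ℕ
    labels xs = length (filter P? xs) + length (filter Q? xs)

    labels-bound : ∀ x xs → Linked (λ a b → ¬ (Q a × P b)) (x ∷ xs) →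
      labels (x ∷ xs) ≤ suc (length (x ∷ xs)) × (¬ P x → labels (x ∷ xs) ≤ length (x ∷ xs))
    labels-bound x [] _ with P? x | Q? x
    ... | yes px | yes _ = s≤s (s≤s z≤n) , λ ¬px → ⊥-elim (¬px px)
    ... | yes px | no _  = s≤s z≤n       , λ ¬px → ⊥-elim (¬px px)
    ... | no _   | yes _ = s≤s z≤n       , λ _ → s≤s z≤n
    ... | no _   | no _  = z≤n           , λ _ → z≤n
    labels-bound x (y ∷ ys) (¬qx×py ∷ l) with labels-bound y ys l | P? x | Q? x
    ... | tail≤ , _     | yes px | no _  = s≤s tail≤ , λ ¬px → ⊥-elim (¬px px)
    ... | tail≤ , _     | no _   | no _  = ≤-trans tail≤ (n≤1+n _) , λ _ → tail≤
    ... | _     , tail≤ | yes px | yes qx =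
      s≤s (≤-trans (≤-reflexive (+-suc _ _)) (s≤s (tail≤ λ py → ¬qx×py (qx , py)))) , λ ¬px → ⊥-elim (¬px px)
    ... | _     , tail≤ | no _   | yes qx =
      let bound = ≤-trans (≤-reflexive (+-suc _ _)) (s≤s (tail≤ λ py → ¬qx×py (qx , py)))
      in ≤-trans bound (n≤1+n _) , λ _ → bound

  length-filter-+-length-filter≤1+length : ∀ {xs} → Linked (λ a b → ¬ (Q a × P b)) xs →
    length (filter P? xs) + length (filter Q? xs) ≤ suc (length xs)
  length-filter-+-length-filter≤1+length {[]}     _ = z≤n
  length-filter-+-length-filter≤1+length {x ∷ xs} l = proj₁ (labels-bound x xs l)

module _ (G : Digraph) where

  lastOf-++ : ∀ u p b q → lastOf G u (p ++ b ∷ q) ≡ lastOf G b q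
  lastOf-++ u []      b q = refl
  lastOf-++ u (x ∷ p) b q = lastOf-++ x p b q

  Linked-fromSplits : ∀ {r} {R : Fin (n G) → Fin (n G) → Set r} u ys →
    (∀ p b q → ys ≡ p ++ b ∷ q → R (lastOf G u p) b) → Linked R (u ∷ ys)
  Linked-fromSplits u []       _     = [-]
  Linked-fromSplits u (b ∷ ys) split =
    split [] b ys refl ∷ Linked-fromSplits b ys (λ p c q e → split (b ∷ p) c q (cong (b ∷_) e))

  IsPathFromTo-split : ∀ {u w} p b q → IsPathFromTo G u w (u ∷ p ++ b ∷ q) →
    IsPathFromTo G u (lastOf G u p) (u ∷ p) × IsPathFromTo G b w (b ∷ q) × Disjoint (u ∷ p) (b ∷ q)
  IsPathFromTo-split {u} p b q (_ , refl , linked , unique , refl)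
    with Linked-++⁻ (u ∷ p) linked | Unique-++⁻ (u ∷ p) unique
  ... | linked₁ , linked₂ | unique₁ , unique₂ , disjoint =
    (p , refl , linked₁ , unique₁ , refl) ,
    (q , refl , linked₂ , unique₂ , sym (lastOf-++ u p b q)) ,
    disjoint

  Covers-split : ∀ xs ys → Covers G (xs ++ ys) → CoveredBy G (xs ∷ ys ∷ [])
  Covers-split xs ys cover v with ∈-++⁻ xs (cover v)
  ... | inj₁ v∈xs = here v∈xs
  ... | inj₂ v∈ys = there (here v∈ys)

module _ {k G} {inc out : Fin k → Fin (n G)} (io : IsInOut k G inc out) where
  open IsInOut io

  IsIncoming : Pred (Fin (n G)) _
  IsIncoming v = ∃ λ j → inc j ≡ v

  IsOutgoing : Pred (Fin (n G)) _
  IsOutgoing v = ∃ λ m → out m ≡ v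

  IsIncoming? : Decidable IsIncoming
  IsIncoming? v = any? λ j → inc j ≟ v

  IsOutgoing? : Decidable IsOutgoing
  IsOutgoing? v = any? λ m → out m ≟ v

  outgoing-not-before-incoming : ∀ {j m} ys p b q → ys ≡ p ++ b ∷ q →
    IsPathFromTo G (inc j) (out m) (inc j ∷ ys) → Covers G (inc j ∷ ys) →
    ¬ (IsOutgoing (lastOf G (inc j) p) × IsIncoming b)
  outgoing-not-before-incoming {j} {m} _ p b q refl ham cover ((m′ , out-m′) , (j′ , refl))
    with IsPathFromTo-split G p b q ham
  ... | first , second , disjoint = single-visit
    ( (inc j ∷ p) ∷ (inc j′ ∷ q) ∷ []
    , s≤s (s≤s z≤n)
    , (j , m′ , subst (λ v → IsPathFromTo G _ v _) (sym out-m′) first) ∷ (j′ , m , second) ∷ []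
    , (disjoint ∷ []) ∷ [] ∷ []
    , Covers-split G (inc j ∷ p) (inc j′ ∷ q) cover )

  HamPath⇒outgoing-not-before-incoming : ∀ {j m} xs → IsPathFromTo G (inc j) (out m) xs → Covers G xs →
    Linked (λ a b → ¬ (IsOutgoing a × IsIncoming b)) xs
  HamPath⇒outgoing-not-before-incoming _ (ys , refl , path) cover =
    Linked-fromSplits G _ ys λ p b q ys≡ → outgoing-not-before-incoming ys p b q ys≡ (ys , refl , path) cover

proposition1 : (k : ℕ) → 1 ≤ k → (G : Digraph) → (inc out : Fin k → Fin (n G)) →
    IsInOut k G inc out → 2 * k ∸ 1 ≤ n G
proposition1 (suc k′) _ G inc out io = ∸-monoˡ-≤ 1 (begin
  k + (k + 0)                                 ≡⟨ cong (k +_) (+-identityʳ k) ⟩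
  k + k                                       ≤⟨ +-mono-≤ (labelled inc-injective (IsIncoming? io) (λ j → j , refl))
                                                          (labelled out-injective (IsOutgoing? io) (λ m → m , refl)) ⟩
  length (filter (IsIncoming? io) xs) + length (filter (IsOutgoing? io) xs)
                                              ≤⟨ length-filter-+-length-filter≤1+length (IsIncoming? io) (IsOutgoing? io)
                                                   (HamPath⇒outgoing-not-before-incoming io xs path cover) ⟩
  suc (length xs)                             ≤⟨ s≤s (injective⇒≤ (Unique⇒lookup-injective unique)) ⟩
  suc (n G)                                   ∎)
  where
  open IsInOut io
  open ≤-Reasoning
  k : ℕ
  k = suc k′

  hamiltonian : HamPath G (inc Fin.zero) (out Fin.zero)
  hamiltonian = proj₂ (paired Fin.zero Fin.zero) refl

  xs : List (Fin (n G))
  xs = proj₁ hamiltonian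

  path : IsPathFromTo G (inc Fin.zero) (out Fin.zero) xs
  path = proj₁ (proj₂ hamiltonian)

  cover : Covers G xs
  cover = proj₂ (proj₂ hamiltonian)

  unique : Unique xs
  unique = proj₁ (proj₂ (proj₂ (proj₂ path)))

  labelled : ∀ {P : Pred (Fin (n G)) _} {f : Fin k → Fin (n G)} → Injective _≡_ _≡_ f →
    (P? : Decidable P) → (∀ j → P (f j)) → k ≤ length (filter P? xs)
  labelled {f = f} f-inj P? Pf = injective-∈⇒≤-length f f-inj λ j → ∈-filter⁺ P? (cover (f j)) (Pf j)
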